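{- The assignment $X\mapsto\mathcal{P}(X)$, $R\mapsto\mathrm{Low}(R)$ is a functor $\mathbf{REL}\to\mathbf{CABARel}$. That is, $\mathrm{Low}(R)$ is directionally atomic for every relation $R$; for every set $X$, $\mathrm{Low}(\mathrm{id}_X)$ is the inclusion relation $\subseteq$ on $\mathcal{P}(X)$; and for all relations $R : X\to\!\!\!\!\!\mapsto Y$, $S : Y\to\!\!\!\!\!\mapsto Z$, $\mathrm{Low}(R;S) = \mathrm{Low}(R);\mathrm{Low}(S)$.
   Context: A relation $R : X\to\!\!\!\!\!\mapsto Y$ is a subset of $X\times Y$; composition is in diagrammatic order: $a\mathrel{(R;S)}c$ iff $\exists b.\ a\mathrel{R}b\mathrel{S}c$. $\mathbf{REL}$ is the category of sets and relations with identity relations $\mathrm{id}_X$. The lower relation $\mathrm{Low}(R) : \mathcal{P}(X)\to\!\!\!\!\!\mapsto\mathcal{P}(Y)$ is $S\mathrel{\mathrm{Low}(R)}T$ iff $\forall s\in S\ \exists t\in T.\ s\mathrel{R}t$. An atom of a poset with bottom $\bot$ is $a\neq\bot$ with $x\sqsubseteq a\Rightarrow x\in\{\bot,a\}$; a CABA is a complete Boolean algebra in which every element is the join of atoms below it. A relation $R : \mathcal{B}\to\!\!\!\!\!\mapsto\mathcal{B}'$ between CABAs is directionally atomic if it is a bimodule ($p'\sqsubseteq p\mathrel{R}q\sqsubseteq q'\Rightarrow p'\mathrel{R}q'$), left-disjunctive (for any family, $a_i\mathrel{R}b$ for all $i$ implies $(\bigsqcup_i a_i)\mathrel{R}b$)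 and atomic-founded (if $a$ is an atom and $a\mathrel{R}b$ there is an atom $b'\sqsubseteq b$ with $a\mathrel{R}b'$). $\mathbf{CABARel}$ is the category of CABAs and directionally atomic relations with relational composition and identities $\sqsubseteq$. -}

module Defs where

open import Level using (0ℓ; _⊔_)
open import Data.Empty using (⊥)
open import Data.Product using (Σ; ∃; _×_; _,_)
open import Data.Sum using (_⊎_)
open import Relation.Nullary using (¬_)
open import Relation.Unary using (Pred; _⊆_; _≐_; ∅; ⋃)
open import Relation.Binary.Core using (REL)

-- The powerset P(X), ordered by inclusion (the order of the Boolean
-- algebra P(X)); bottom is ∅, joins are unions ⋃, equality is
-- extensional (mutual inclusion).
𝒫 : Set → Set₁
𝒫 X = Pred X 0ℓ

Low : {X Y : Set} → REL X Y 0ℓ → REL (𝒫 X) (𝒫 Y) 0ℓ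
Low R S T = ∀ {s} → S s → ∃ λ t → T t × R s t

IsAtom : {X : Set} → 𝒫 X → Set₁
IsAtom a = (¬ (a ≐ ∅)) × (∀ (x : 𝒫 _) → x ⊆ a → (x ≐ ∅) ⊎ (x ≐ a))

IsBimodule : {X Y : Set} → REL (𝒫 X) (𝒫 Y) 0ℓ → Set₁
IsBimodule R = ∀ {p p′ q q′} → p′ ⊆ p → R p q → q ⊆ q′ → R p′ q′

IsLeftDisjunctive : {X Y : Set} → REL (𝒫 X) (𝒫 Y) 0ℓ → Set₁
IsLeftDisjunctive R =
  ∀ (I : Set) (a : I → 𝒫 _) b → (∀ i → R (a i) b) → R (⋃ I a) b

IsAtomicFounded : {X Y : Set} → REL (𝒫 X) (𝒫 Y) 0ℓ → Set₁
IsAtomicFounded R =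
  ∀ a b → IsAtom a → R a b → Σ (𝒫 _) λ b′ → IsAtom b′ × b′ ⊆ b × R a b′

IsDirectionallyAtomic : {X Y : Set} → REL (𝒫 X) (𝒫 Y) 0ℓ → Set₁
IsDirectionallyAtomic R =
  IsBimodule R × IsLeftDisjunctive R × IsAtomicFounded R

infixr 9 _⨾_
_⨾_ : ∀ {a b c ℓ₁ ℓ₂} {A : Set a} {B : Set b} {C : Set c} →
      REL A B ℓ₁ → REL B C ℓ₂ → REL A C (b ⊔ ℓ₁ ⊔ ℓ₂)
_⨾_ {B = B} L R = λ i j → Σ B λ k → L i k × R k j

{-# OPTIONS --safe #-}
-- Classically the atoms of 𝒫 X are exactly the singletons, so Low R is
-- atomic-founded: an atom { x } related to T has an R-successor t of x in T,
-- and { t } ⊆ T is the atom we need.  For composition, Low (R ⨾ S) A C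
-- factors through the set of those y that have an S-successor in C.
module Submission where

open import Defs
open import Level using (0ℓ)
open import Data.Empty using (⊥-elim)
open import Data.Product using (_×_; _,_; ∃; proj₁)
open import Data.Sum using (_⊎_; inj₁; inj₂)
open import Relation.Nullary using (¬_; yes; no)
open import Relation.Unary using (_⊆_; _≐_; ∅; ｛_｝; Satisfiable)
open import Relation.Binary.Core using (REL; _⇒_; _⇔_)
open import Relation.Binary.PropositionalEquality using (_≡_; refl; sym; subst)
open import Axiom.ExcludedMiddle using (ExcludedMiddle)

module _ {X Y : Set} (R : REL X Y 0ℓ) where

  Low-isBimodule : IsBimodule (Low R)
  Low-isBimodule p′⊆p low q⊆q′ s∈p′ with low (p′⊆p s∈p′)
  ... | t , t∈q , sRt = t , q⊆q′ t∈q , sRt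

  Low-isLeftDisjunctive : IsLeftDisjunctive (Low R)
  Low-isLeftDisjunctive _ _ _ low (i , s∈aᵢ) = low i s∈aᵢ

  Low-⊆｛｝ : ∀ {a x t} → a ⊆ ｛ x ｝ → R x t → Low R a ｛ t ｝
  Low-⊆｛｝ a⊆x xRt s∈a with a⊆x s∈a
  ... | refl = _ , refl , xRt

IsAtom⇒⊆｛｝ : {X : Set} {a : 𝒫 X} {x : X} → IsAtom a → a x → a ⊆ ｛ x ｝
IsAtom⇒⊆｛｝ (_ , below-a) x∈a with below-a ｛ _ ｝ (λ { refl → x∈a })
... | inj₁ (x∈∅ , _) = ⊥-elim (x∈∅ refl)
... | inj₂ (_ , a⊆x) = a⊆x

module _ (em : ExcludedMiddle 0ℓ) where

  nonempty⇒satisfiable : {X : Set} {a : 𝒫 X} → ¬ (a ≐ ∅) → Satisfiable a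
  nonempty⇒satisfiable {a = a} a≉∅ with em {Satisfiable a}
  ... | yes sat = sat
  ... | no ¬sat = ⊥-elim (a≉∅ ((λ x∈a → ¬sat (_ , x∈a)) , λ ()))

  ｛｝-isAtom : {X : Set} (x : X) → IsAtom ｛ x ｝
  ｛｝-isAtom x = (λ (x⊆∅ , _) → x⊆∅ refl) , below-｛｝
    where
    below-｛｝ : (z : 𝒫 _) → z ⊆ ｛ x ｝ → (z ≐ ∅) ⊎ (z ≐ ｛ x ｝)
    below-｛｝ z z⊆x with em {z x}
    ... | yes x∈z = inj₂ (z⊆x , λ { refl → x∈z })
    ... | no x∉z  = inj₁ ((λ y∈z → x∉z (subst z (sym (z⊆x y∈z)) y∈z)) , λ ())

  Low-isAtomicFounded : {X Y : Set} (R : REL X Y 0ℓ) → IsAtomicFounded (Low R)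
  Low-isAtomicFounded R a b a-atom low with nonempty⇒satisfiable (proj₁ a-atom)
  ... | x , x∈a with low x∈a
  ... | t , t∈b , xRt =
    ｛ t ｝ , ｛｝-isAtom t , (λ { refl → t∈b }) , Low-⊆｛｝ R (IsAtom⇒⊆｛｝ a-atom x∈a) xRt

  Low-isDirectionallyAtomic : {X Y : Set} (R : REL X Y 0ℓ) → IsDirectionallyAtomic (Low R)
  Low-isDirectionallyAtomic R =
    Low-isBimodule R , Low-isLeftDisjunctive R , Low-isAtomicFounded R

Low-≡⇔⊆ : {X : Set} → Low {X} {X} _≡_ ⇔ _⊆_
Low-≡⇔⊆ = Low-≡⇒⊆ , ⊆⇒Low-≡
  where
  Low-≡⇒⊆ : Low _≡_ ⇒ _⊆_
  Low-≡⇒⊆ low s∈S with low s∈S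
  ... | _ , t∈T , refl = t∈T

  ⊆⇒Low-≡ : _⊆_ ⇒ Low _≡_
  ⊆⇒Low-≡ S⊆T s∈S = _ , S⊆T s∈S , refl

module _ {X Y Z : Set} (R : REL X Y 0ℓ) (S : REL Y Z 0ℓ) where

  Low-⨾⇒Low-⨾-Low : Low (R ⨾ S) ⇒ (Low R ⨾ Low S)
  Low-⨾⇒Low-⨾-Low {y = C} low = S-into C , Low-R , Low-S
    where
    S-into : 𝒫 Z → 𝒫 Y
    S-into C y = ∃ λ c → C c × S y c

    Low-R : Low R _ (S-into C)
    Low-R a∈A with low a∈A
    ... | c , c∈C , y , aRy , ySc = y , (c , c∈C , ySc) , aRy

    Low-S : Low S (S-into C) C
    Low-S (c , c∈C , ySc) = c , c∈C , ySc

  Low-⨾-Low⇒Low-⨾ : (Low R ⨾ Low S) ⇒ Low (R ⨾ S)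
  Low-⨾-Low⇒Low-⨾ (B , lowR , lowS) a∈A with lowR a∈A
  ... | y , y∈B , aRy with lowS y∈B
  ... | c , c∈C , ySc = c , c∈C , y , aRy , ySc

  Low-distrib-⨾ : Low (R ⨾ S) ⇔ (Low R ⨾ Low S)
  Low-distrib-⨾ = Low-⨾⇒Low-⨾-Low , Low-⨾-Low⇒Low-⨾

mainTheorem10 : ExcludedMiddle 0ℓ →
    ((X Y : Set) (R : REL X Y 0ℓ) → IsDirectionallyAtomic (Low R))
    × ((X : Set) → Low {X} {X} _≡_ ⇔ _⊆_)
    × ((X Y Z : Set) (R : REL X Y 0ℓ) (S : REL Y Z 0ℓ) → Low (R ⨾ S) ⇔ (Low R ⨾ Low S))
mainTheorem10 em =
    (λ _ _ → Low-isDirectionallyAtomic em)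
  , (λ _ → Low-≡⇔⊆)
  , (λ _ _ _ → Low-distrib-⨾)
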